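{- Let $p$ be a good prime with $\Delta\not\equiv0\pmod p$. Then for every $n\in\mathbb{Z}$, $$\mathfrak{S}_p(n)=\frac{1+p\left(\frac{n^2-4\Delta}{p}\right)}{p^2-1},$$ where $\left(\frac{\cdot}{p}\right)$ is the Legendre symbol.
   Context: $\Gamma<\mathrm{SL}_2(\mathbb{Z})$ is Zariski dense in $\mathrm{SL}_2$. $A,B,C,D$ are integers with $\gcd(A,B,C,D)=1$; for $\gamma=\begin{pmatrix}a&b\\c&d\end{pmatrix}$ put $\mathscr{L}(\gamma)=Aa+Bb+Cc+Dd$, and $\Delta=AD-BC$. For $q\ge1$, $\Gamma(q)=\{\gamma\in\Gamma:\gamma\equiv I\pmod q\}$. A prime $p$ is good if $p$ is odd and for every $\ell\ge1$ the reduction map $\Gamma\to\mathrm{SL}_2(\mathbb{Z}/p^\ell\mathbb{Z})$ is surjective. $c_q(x)=\sum_{r \bmod q,(r,q)=1}e^{2\pi i rx/q}$ is the Ramanujan sum, and $\mathfrak{S}_q(n)=\frac1{[\Gamma:\Gamma(q)]}\sum_{\gamma\in\Gamma(q)\backslash\Gamma}c_q(\mathscr{L}(\gamma)-n)$. -}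

module Defs where

open import Data.Nat as ℕ using (ℕ; zero; suc)
open import Data.Nat.Divisibility as ℕD using ()
open import Data.Integer as ℤ using (ℤ; +_; _+_; _-_; _*_; -_; ∣_∣)
open import Data.Integer.Divisibility using (_∣_)
open import Data.List using (List; []; _∷_; map; foldr; filter; upTo)

sumℤ : List ℤ → ℤ
sumℤ = foldr _+_ (+ 0)
open import Data.Rational as ℚ using (ℚ)
open import Relation.Nullary using (¬_; yes; no; does)
open import Relation.Binary.PropositionalEquality using (_≡_)
open import Data.Bool using (Bool; true; false; if_then_else_)
open import Data.Product using (Σ; _×_; ∃; _,_)

record Mat2 : Set where
  constructor mat
  field
    a b c d : ℤ
open Mat2 public

det : Mat2 → ℤ
det M = a M * d M - b M * c M

I₂ : Mat2
I₂ = mat (+ 1) (+ 0) (+ 0) (+ 1)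

_·_ : Mat2 → Mat2 → Mat2
M · N = mat (a M * a N + b M * c N) (a M * b N + b M * d N)
            (c M * a N + d M * c N) (c M * b N + d M * d N)

-- inverse of a determinant-one matrix (the adjugate)
inv : Mat2 → Mat2
inv M = mat (d M) (- b M) (- c M) (a M)

_≡[_]_ : ℤ → ℕ → ℤ → Set
x ≡[ q ] y = (+ q) ∣ (x - y)

_≡M[_]_ : Mat2 → ℕ → Mat2 → Set
M ≡M[ q ] N = (a M ≡[ q ] a N) × (b M ≡[ q ] b N) × (c M ≡[ q ] c N) × (d M ≡[ q ] d N)

record IsSubgroupSL2 (Γ : Mat2 → Set) : Set where
  field
    inSL2   : ∀ {γ} → Γ γ → det γ ≡ + 1
    one∈    : Γ I₂
    mul∈    : ∀ {γ δ} → Γ γ → Γ δ → Γ (γ · δ)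
    inv∈    : ∀ {γ} → Γ γ → Γ (inv γ)

data Poly4 : Set where
  const : ℤ → Poly4
  xa xb xc xd : Poly4
  _⊕_ _⊗_ : Poly4 → Poly4 → Poly4

eval : Poly4 → Mat2 → ℤ
eval (const k) M = k
eval xa M = a M
eval xb M = b M
eval xc M = c M
eval xd M = d M
eval (P ⊕ Q) M = eval P M + eval Q M
eval (P ⊗ Q) M = eval P M * eval Q M

-- Zariski density in SL₂: every polynomial vanishing on Γ vanishes on SL₂
-- (tested on the Zariski-dense set of integer points SL₂(ℤ)).
ZariskiDenseSL2 : (Mat2 → Set) → Set
ZariskiDenseSL2 Γ =
  ∀ (P : Poly4) → (∀ γ → Γ γ → eval P γ ≡ + 0) →
  ∀ (M : Mat2) → det M ≡ + 1 → eval P M ≡ + 0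

Γ[_]_ : ℕ → (Mat2 → Set) → Mat2 → Set
(Γ[ q ] Γ) γ = Γ γ × (γ ≡M[ q ] I₂)

SameCoset : (Mat2 → Set) → ℕ → Mat2 → Mat2 → Set
SameCoset Γ q γ₁ γ₂ = (Γ[ q ] Γ) (γ₁ · inv γ₂)

-- Good primes: odd, and Γ → SL₂(ℤ/p^ℓ) surjective for every ℓ ≥ 1
-- (elements of SL₂(ℤ/p^ℓ) represented by integer matrices of
--  determinant ≡ 1 mod p^ℓ)

ReductionSurjective : (Mat2 → Set) → ℕ → Set
ReductionSurjective Γ m =
  ∀ (M : Mat2) → det M ≡[ m ] (+ 1) → Σ Mat2 λ γ → Γ γ × (γ ≡M[ m ] M)

open import Data.Nat.Primality using (Prime)

Good : (Mat2 → Set) → ℕ → Set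
Good Γ p = Prime p × ¬ (2 ℕD.∣ p) × (∀ (ℓ : ℕ) → 1 ℕ.≤ ℓ → ReductionSurjective Γ (p ℕ.^ ℓ))

divides? : ℕ → ℤ → Bool
divides? q x = does (q ℕD.∣? ∣ x ∣)

-- Ramanujan sums, defined via the orthogonality relation
--   Σ_{d ∣ q} c_d(x) = Σ_{r mod q} e(rx/q) = q·[q ∣ x]   (q ≥ 1),
-- i.e. c_q(x) = q·[q ∣ x] − Σ_{d ∣ q, d < q} c_d(x).
-- The first argument is fuel (≥ q suffices).
ramanujan′ : ℕ → ℕ → ℤ → ℤ
ramanujan′ zero q x = + 0
ramanujan′ (suc f) q x =
  (if divides? q x then + q else + 0)
  - sumℤ (map (λ d → ramanujan′ f d x)
             (filter (λ d → d ℕD.∣? q) (filter (λ d → 1 ℕ.≤? d) (upTo q))))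

ramanujanSum : ℕ → ℤ → ℤ
ramanujanSum q x = ramanujan′ q q x

legendre : ℤ → ℕ → ℤ
legendre x p with divides? p x
... | true = + 0
... | false with filter (λ y → p ℕD.∣? ∣ (+ y) * (+ y) - x ∣) (upTo p)
...   | [] = - (+ 1)
...   | _ ∷ _ = + 1

L : ℤ → ℤ → ℤ → ℤ → Mat2 → ℤ
L A B C D γ = A * a γ + B * b γ + C * c γ + D * d γ

Δ : ℤ → ℤ → ℤ → ℤ → ℤ
Δ A B C D = A * D - B * C

-- integer divided by natural number, as a rational (convention: x / 0 = 0)
_/ℕ_ : ℤ → ℕ → ℚ
x /ℕ zero = ℚ.0ℚ
x /ℕ suc k = x ℚ./ suc k

open import Data.List.Relation.Unary.All using (All)
open import Data.List.Relation.Unary.AllPairs using (AllPairs)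
open import Data.List.Membership.Propositional using (_∈_)

IsCosetReps : (Mat2 → Set) → ℕ → List Mat2 → Set
IsCosetReps Γ q reps =
  All Γ reps
  × (∀ γ → Γ γ → Σ Mat2 λ r → r ∈ reps × SameCoset Γ q γ r)
  × AllPairs (λ r s → ¬ SameCoset Γ q r s) reps

singularSeries : ℤ → ℤ → ℤ → ℤ → ℕ → ℤ → List Mat2 → ℚ
singularSeries A B C D q n reps =
  sumℤ (map (λ γ → ramanujanSum q (L A B C D γ - n)) reps) /ℕ Data.List.length reps

{-# OPTIONS --safe #-}
-- Reduction modulo p identifies Γ(p)\Γ with SL₂(𝔽ₚ), so a system of coset representatives is a
-- copy of SL₂(𝔽ₚ), of order p(p² − 1), and since p is prime c_p(x) = p·[p ∣ x] − 1.  Hence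
-- 𝔖_p(n) = (p·#{γ ∈ SL₂(𝔽ₚ) : L(γ) = n} − p(p² − 1)) / (p(p² − 1)).  Write L(γ) = tr(Nγ) with
-- N = (A C; B D); det N = Δ is a unit mod p, so γ ↦ Nγ maps {det = 1, L = n} bijectively onto
-- {det = Δ, tr = n}.  A matrix with diagonal (x, n − x) has determinant Δ iff yz = x(n − x) − Δ,
-- which has p − 1 solutions (y, z), plus p more when x(n − x) = Δ; completing the square, there
-- are 1 + (n² − 4Δ / p) such x.  So the count is p² + p·(n² − 4Δ / p), and the formula follows.

module Submission where

open import Defs
open import Data.Bool using (if_then_else_)
open import Data.Empty using (⊥-elim)
open import Data.Nat as ℕ using (ℕ; suc; _∸_)
import Data.Nat.Divisibility as ℕ
import Data.Nat.Properties as ℕ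
import Data.Nat.DivMod as ℕ
open import Data.Nat.Coprimality using (coprime-Bézout; prime⇒coprime)
open import Data.Nat.GCD using (module Bézout)
open import Data.Nat.Primality using (Prime; composite; prime⇒nonZero; euclidsLemma; prime⇒irreducible; prime[2]; ¬prime[1])
import Data.Rational.Properties as ℚ
import Data.Rational.Unnormalised.Base as ℚᵘ
open import Data.Integer.DivMod using (_%ℕ_; a≡a%ℕn+[a/ℕn]*n; n%ℕd<d)
import Data.Integer
open import Data.Integer as ℤ using (ℤ; +_; _+_; _-_; _*_; -_; ∣_∣; _⊖_)
open import Data.Integer.GCD using (gcd)
open import Data.Integer.Divisibility using (_∣_)
import Data.Integer.Properties as ℤ
import Data.Integer.Divisibility.Signed as ℤS
open import Data.Integer.Tactic.RingSolver using (solve-∀; solve)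
open import Data.List using (List; []; _∷_; map; length; concatMap; _++_; filter; upTo; applyUpTo)
open import Data.List.Properties using (length-map; length-upTo; filter-all; filter-accept; filter-none)
open import Data.List.Membership.Propositional using (_∈_; lose)
open import Data.List.Membership.Propositional.Properties using (∈-upTo⁺; ∈-filter⁻; ∈-applyUpTo⁻)
open import Data.List.Relation.Unary.AllPairs.Properties using (applyUpTo⁺₁)
open import Data.List.Relation.Unary.All as All using (All)
open import Data.List.Relation.Unary.All.Properties using (All¬⇒¬Any)
open import Level using (0ℓ)
open import Data.List.Relation.Unary.Any using (Any; here; there)
open import Data.List.Relation.Unary.AllPairs using (AllPairs)
open import Data.Product using (∃; _×_; _,_; proj₁; proj₂; map₂)
open import Data.Sum as Sum using (_⊎_; inj₁; inj₂)
open import Function using (_∘_; _$_; id; case_of_; _⇔_; mk⇔; Equivalence)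
open import Function.Construct.Composition using (_⇔-∘_)
open import Relation.Binary using (Rel; IsEquivalence; Setoid; Decidable; _Preserves_⟶_; _Respects_)
open import Relation.Binary.PropositionalEquality hiding ([_])
open import Relation.Nullary using (¬_; Dec; yes; no; _×-dec_)
open import Relation.Nullary.Decidable using (map′; dec-true)
import Relation.Binary.Reasoning.Setoid as SetoidReasoning
open import Relation.Unary using (Pred)
import Relation.Unary as U

-- Iverson brackets and finite sums

𝟙 : {P : Set} → Dec P → ℤ
𝟙 (yes _) = + 1
𝟙 (no _)  = + 0

private
  variable
    P Q R : Set

𝟙-yes : (P? : Dec P) → P → 𝟙 P? ≡ + 1
𝟙-yes (yes _) _  = refl
𝟙-yes (no ¬p) p = ⊥-elim (¬p p)

𝟙-no : (P? : Dec P) → ¬ P → 𝟙 P? ≡ + 0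
𝟙-no (yes p) ¬p = ⊥-elim (¬p p)
𝟙-no (no _)  _  = refl

𝟙-cong : (P? : Dec P) (Q? : Dec Q) → P ⇔ Q → 𝟙 P? ≡ 𝟙 Q?
𝟙-cong (yes _) (yes _) _   = refl
𝟙-cong (yes p) (no ¬q) P⇔Q = ⊥-elim (¬q (Equivalence.to P⇔Q p))
𝟙-cong (no ¬p) (yes q) P⇔Q = ⊥-elim (¬p (Equivalence.from P⇔Q q))
𝟙-cong (no _)  (no _)  _   = refl

𝟙-× : (P? : Dec P) (Q? : Dec Q) → 𝟙 (P? ×-dec Q?) ≡ 𝟙 P? * 𝟙 Q?
𝟙-× (yes _) (yes _) = refl
𝟙-× (yes _) (no _)  = refl
𝟙-× (no _)  (yes _) = refl
𝟙-× (no _)  (no _)  = refl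

𝟙-⊎ : (R? : Dec R) (P? : Dec P) (Q? : Dec Q) → R ⇔ (P ⊎ Q) → ¬ (P × Q) → 𝟙 R? ≡ 𝟙 P? + 𝟙 Q?
𝟙-⊎ (yes _) (yes p) (yes q) _   ¬p×q = ⊥-elim (¬p×q (p , q))
𝟙-⊎ (yes _) (yes _) (no _)  _   _    = refl
𝟙-⊎ (yes _) (no _)  (yes _) _   _    = refl
𝟙-⊎ (yes r) (no ¬p) (no ¬q) R⇔P⊎Q _  = ⊥-elim (Sum.[ ¬p , ¬q ] (Equivalence.to R⇔P⊎Q r))
𝟙-⊎ (no ¬r) (yes p) _       R⇔P⊎Q _  = ⊥-elim (¬r (Equivalence.from R⇔P⊎Q (inj₁ p)))
𝟙-⊎ (no ¬r) (no _)  (yes q) R⇔P⊎Q _  = ⊥-elim (¬r (Equivalence.from R⇔P⊎Q (inj₂ q)))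
𝟙-⊎ (no _)  (no _)  (no _)  _   _    = refl

𝟙-*-cong : (P? : Dec P) {x y : ℤ} → (P → x ≡ y) → 𝟙 P? * x ≡ 𝟙 P? * y
𝟙-*-cong (yes p) x≡y = cong (+ 1 *_) (x≡y p)
𝟙-*-cong (no _)  _   = refl

𝟙-case : (P? : Dec P) {f a b : ℤ} → (P → f ≡ a) → (¬ P → f ≡ b) → f ≡ (a - b) * 𝟙 P? + b
𝟙-case (yes p) {a = a} {b} f≡a _ = trans (f≡a p) (sym (one a b))
  where
  one : ∀ a b → (a - b) * + 1 + b ≡ a
  one = solve-∀
𝟙-case (no ¬p) {a = a} {b} _ f≡b = trans (f≡b ¬p) (sym (zero a b))
  where
  zero : ∀ a b → (a - b) * + 0 + b ≡ b
  zero = solve-∀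

𝟙-absorbs : (P? : Dec P) {s y : ℤ} → (P → s ≡ + 1) → s * (𝟙 P? * y) ≡ 𝟙 P? * y
𝟙-absorbs (yes p) {s} {y} s≡1 = trans (cong (_* (+ 1 * y)) (s≡1 p)) (ℤ.*-identityˡ _)
𝟙-absorbs (no _)  {s}     _   = ℤ.*-zeroʳ s

∑ : {A : Set} → List A → (A → ℤ) → ℤ
∑ xs f = sumℤ (map f xs)

module _ {A : Set} where

  open import Data.List.Relation.Unary.All using ([]; _∷_)
  open import Data.List.Relation.Unary.AllPairs using ([]; _∷_)

  ∑-cong : (xs : List A) {f g : A → ℤ} → f ≗ g → ∑ xs f ≡ ∑ xs g
  ∑-cong []       f≗g = refl
  ∑-cong (x ∷ xs) f≗g = cong₂ _+_ (f≗g x) (∑-cong xs f≗g)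

  ∑-cong-All : {xs : List A} {f g : A → ℤ} → All (λ x → f x ≡ g x) xs → ∑ xs f ≡ ∑ xs g
  ∑-cong-All []           = refl
  ∑-cong-All (fx≡gx ∷ eq) = cong₂ _+_ fx≡gx (∑-cong-All eq)

  ∑-distrib-+ : (xs : List A) (f g : A → ℤ) → ∑ xs (λ x → f x + g x) ≡ ∑ xs f + ∑ xs g
  ∑-distrib-+ []       f g = refl
  ∑-distrib-+ (x ∷ xs) f g = trans (cong (_+_ (f x + g x)) (∑-distrib-+ xs f g)) (swap (f x) (g x) _ _)
    where
    swap : ∀ a b c d → a + b + (c + d) ≡ a + c + (b + d)
    swap = solve-∀

  *-distribˡ-∑ : (c : ℤ) (xs : List A) (f : A → ℤ) → c * ∑ xs f ≡ ∑ xs (λ x → c * f x)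
  *-distribˡ-∑ c []       f = ℤ.*-zeroʳ c
  *-distribˡ-∑ c (x ∷ xs) f = trans (ℤ.*-distribˡ-+ c (f x) (∑ xs f)) (cong (_+_ (c * f x)) (*-distribˡ-∑ c xs f))

  *-distribʳ-∑ : (c : ℤ) (xs : List A) (f : A → ℤ) → ∑ xs f * c ≡ ∑ xs (λ x → f x * c)
  *-distribʳ-∑ c xs f = begin
    ∑ xs f * c              ≡⟨ ℤ.*-comm (∑ xs f) c ⟩
    c * ∑ xs f              ≡⟨ *-distribˡ-∑ c xs f ⟩
    ∑ xs (λ x → c * f x)    ≡⟨ ∑-cong xs (λ x → ℤ.*-comm c (f x)) ⟩
    ∑ xs (λ x → f x * c)    ∎
    where open ≡-Reasoning

  ∑-const : (xs : List A) (c : ℤ) → ∑ xs (λ _ → c) ≡ + length xs * c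
  ∑-const []       c = sym (ℤ.*-zeroˡ c)
  ∑-const (x ∷ xs) c = trans (cong (_+_ c) (∑-const xs c)) (sym (ℤ.suc-* (+ length xs) c))

  ∑-affine : (xs : List A) (f : A → ℤ) (s t : ℤ) → ∑ xs (λ x → s * f x + t) ≡ s * ∑ xs f + + length xs * t
  ∑-affine xs f s t = trans (∑-distrib-+ xs _ _) (cong₂ _+_ (sym (*-distribˡ-∑ s xs f)) (∑-const xs t))

  ∑-++ : (xs ys : List A) (f : A → ℤ) → ∑ (xs ++ ys) f ≡ ∑ xs f + ∑ ys f
  ∑-++ []       ys f = sym (ℤ.+-identityˡ (∑ ys f))
  ∑-++ (x ∷ xs) ys f = trans (cong (_+_ (f x)) (∑-++ xs ys f)) (sym (ℤ.+-assoc (f x) _ _))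

  AllPairs-map-All : {P : Pred A 0ℓ} {R S : Rel A 0ℓ} → (∀ {x y} → P x → P y → R x y → S x y) →
                     {xs : List A} → All P xs → AllPairs R xs → AllPairs S xs
  AllPairs-map-All f []         []         = []
  AllPairs-map-All f (px ∷ pxs) (rx ∷ rxs) = All.zipWith (λ (py , r) → f px py r) (pxs , rx) ∷ AllPairs-map-All f pxs rxs

  module _ {P : Pred A 0ℓ} (P? : U.Decidable P) where

    ∑-𝟙-none : {xs : List A} → All (¬_ ∘ P) xs → ∑ xs (𝟙 ∘ P?) ≡ + 0
    ∑-𝟙-none []                   = refl
    ∑-𝟙-none {x ∷ _} (¬px ∷ ¬ps) = cong₂ _+_ (𝟙-no (P? x) ¬px) (∑-𝟙-none ¬ps)

    ∑-𝟙-unique : {xs : List A} → AllPairs (λ x y → P x → ¬ P y) xs → Any P xs → ∑ xs (𝟙 ∘ P?) ≡ + 1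
    ∑-𝟙-unique {x ∷ _} (x∉ ∷ _)      (here px)  = cong₂ _+_ (𝟙-yes (P? x) px) (∑-𝟙-none (All.map (_$ px) x∉))
    ∑-𝟙-unique {x ∷ _} (x∉ ∷ unique) (there py) =
      cong₂ _+_ (𝟙-no (P? x) (λ px → All¬⇒¬Any (All.map (_$ px) x∉) py)) (∑-𝟙-unique unique py)

    ∑-𝟙-filter : (xs : List A) → ∑ xs (𝟙 ∘ P?) ≡ + length (filter P? xs)
    ∑-𝟙-filter []       = refl
    ∑-𝟙-filter (x ∷ xs) with P? x
    ... | yes _ = cong (_+_ (+ 1)) (∑-𝟙-filter xs)
    ... | no _  = trans (ℤ.+-identityˡ _) (∑-𝟙-filter xs)

module _ {A B : Set} where

  ∑-map : (g : A → B) (xs : List A) (f : B → ℤ) → ∑ (map g xs) f ≡ ∑ xs (f ∘ g)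
  ∑-map g []       f = refl
  ∑-map g (x ∷ xs) f = cong (_+_ (f (g x))) (∑-map g xs f)

  ∑-concatMap : (g : A → List B) (xs : List A) (f : B → ℤ) → ∑ (concatMap g xs) f ≡ ∑ xs (λ x → ∑ (g x) f)
  ∑-concatMap g []       f = refl
  ∑-concatMap g (x ∷ xs) f = trans (∑-++ (g x) (concatMap g xs) f) (cong (_+_ (∑ (g x) f)) (∑-concatMap g xs f))

  ∑-comm : (xs : List A) (ys : List B) (f : A → B → ℤ) →
           ∑ xs (λ x → ∑ ys (f x)) ≡ ∑ ys (λ y → ∑ xs (λ x → f x y))
  ∑-comm []       ys f = sym (trans (∑-const ys (+ 0)) (ℤ.*-zeroʳ (+ length ys)))
  ∑-comm (x ∷ xs) ys f = trans (cong (_+_ (∑ ys (f x))) (∑-comm xs ys f)) (sym (∑-distrib-+ ys (f x) _))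

  ∑-product : (xs : List A) (ys : List B) (f : A → ℤ) (g : B → ℤ) →
              ∑ xs (λ x → ∑ ys (λ y → f x * g y)) ≡ ∑ xs f * ∑ ys g
  ∑-product xs ys f g = begin
    ∑ xs (λ x → ∑ ys (λ y → f x * g y))  ≡⟨ ∑-cong xs (λ x → sym (*-distribˡ-∑ (f x) ys g)) ⟩
    ∑ xs (λ x → f x * ∑ ys g)            ≡⟨ sym (*-distribʳ-∑ (∑ ys g) xs f) ⟩
    ∑ xs f * ∑ ys g                      ∎
    where open ≡-Reasoning

-- Complete systems of residues

module ResidueSystem {A : Set} {_~_ : Rel A 0ℓ} (~-isEquivalence : IsEquivalence _~_) (_~?_ : Decidable _~_)
                     (X : List A) (∑X-𝟙 : ∀ z → ∑ X (λ x → 𝟙 (x ~? z)) ≡ + 1) where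

  open IsEquivalence ~-isEquivalence renaming (refl to ~-refl; sym to ~-sym; trans to ~-trans)
  open ≡-Reasoning

  ∑-select : ∀ z {F : A → ℤ} → F Preserves _~_ ⟶ _≡_ → ∑ X (λ x → 𝟙 (x ~? z) * F x) ≡ F z
  ∑-select z {F} F-resp = begin
    ∑ X (λ x → 𝟙 (x ~? z) * F x)  ≡⟨ ∑-cong X (λ x → 𝟙-*-cong (x ~? z) F-resp) ⟩
    ∑ X (λ x → 𝟙 (x ~? z) * F z)  ≡⟨ *-distribʳ-∑ (F z) X (λ x → 𝟙 (x ~? z)) ⟨
    ∑ X (λ x → 𝟙 (x ~? z)) * F z  ≡⟨ cong (_* F z) (∑X-𝟙 z) ⟩
    + 1 * F z                     ≡⟨ ℤ.*-identityˡ (F z) ⟩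
    F z                           ∎

  ∑-reindex : (φ ψ : A → A) → φ Preserves _~_ ⟶ _~_ → ψ Preserves _~_ ⟶ _~_ →
              (∀ x → φ (ψ x) ~ x) → (∀ x → ψ (φ x) ~ x) →
              {F : A → ℤ} → F Preserves _~_ ⟶ _≡_ → ∑ X (F ∘ φ) ≡ ∑ X F
  ∑-reindex φ ψ φ-resp ψ-resp φψ ψφ {F} F-resp = begin
    ∑ X (F ∘ φ)                                 ≡⟨ ∑-cong X (λ x → ∑-select (φ x) F-resp) ⟨
    ∑ X (λ x → ∑ X (λ u → 𝟙 (u ~? φ x) * F u))  ≡⟨ ∑-comm X X _ ⟩
    ∑ X (λ u → ∑ X (λ x → 𝟙 (u ~? φ x) * F u))  ≡⟨ ∑-cong X (λ u → *-distribʳ-∑ (F u) X _) ⟨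
    ∑ X (λ u → ∑ X (λ x → 𝟙 (u ~? φ x)) * F u)  ≡⟨ ∑-cong X (λ u → cong (_* F u) (∑-fibre u)) ⟩
    ∑ X (λ u → + 1 * F u)                       ≡⟨ ∑-cong X (ℤ.*-identityˡ ∘ F) ⟩
    ∑ X F                                       ∎
    where
    ∑-fibre : ∀ u → ∑ X (λ x → 𝟙 (u ~? φ x)) ≡ + 1
    ∑-fibre u = trans (∑-cong X (λ x → 𝟙-cong (u ~? φ x) (x ~? ψ u) (mk⇔ to from))) (∑X-𝟙 (ψ u))
      where
      to : ∀ {x} → u ~ φ x → x ~ ψ u
      to u~φx = ~-trans (~-sym (ψφ _)) (ψ-resp (~-sym u~φx))
      from : ∀ {x} → x ~ ψ u → u ~ φ x
      from x~ψu = ~-trans (~-sym (φψ u)) (φ-resp (~-sym x~ψu))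

  ∑-transversal : {Q : Pred A 0ℓ} (Q? : U.Decidable Q) → Q Respects _~_ →
                  {Y : List A} → All Q Y → (∀ x → Q x → ∑ Y (λ y → 𝟙 (x ~? y)) ≡ + 1) →
                  {F : A → ℤ} → F Preserves _~_ ⟶ _≡_ → ∑ Y F ≡ ∑ X (λ x → 𝟙 (Q? x) * F x)
  ∑-transversal {Q} Q? Q-resp {Y} QY ∑Y-𝟙 {F} F-resp = begin
    ∑ Y F                                      ≡⟨ ∑-cong-All (All.map (λ Qy → sym (trans (∑-select _ G-resp) (G-Q Qy))) QY) ⟩
    ∑ Y (λ y → ∑ X (λ x → 𝟙 (x ~? y) * G x))   ≡⟨ ∑-comm Y X _ ⟩
    ∑ X (λ x → ∑ Y (λ y → 𝟙 (x ~? y) * G x))   ≡⟨ ∑-cong X (λ x → *-distribʳ-∑ (G x) Y _) ⟨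
    ∑ X (λ x → ∑ Y (λ y → 𝟙 (x ~? y)) * G x)   ≡⟨ ∑-cong X count ⟩
    ∑ X G                                      ∎
    where
    G : A → ℤ
    G x = 𝟙 (Q? x) * F x
    G-resp : G Preserves _~_ ⟶ _≡_
    G-resp x~y = cong₂ _*_ (𝟙-cong (Q? _) (Q? _) (mk⇔ (Q-resp x~y) (Q-resp (~-sym x~y)))) (F-resp x~y)
    G-Q : ∀ {x} → Q x → G x ≡ F x
    G-Q {x} Qx = trans (cong (_* F x) (𝟙-yes (Q? x) Qx)) (ℤ.*-identityˡ (F x))
    count : ∀ x → ∑ Y (λ y → 𝟙 (x ~? y)) * G x ≡ G x
    count x = 𝟙-absorbs (Q? x) (∑Y-𝟙 x)

-- Integer 2 × 2 matrices

infixr 7 _⋆_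

_⋆_ : ℤ → Mat2 → Mat2
k ⋆ M = mat (k * a M) (k * b M) (k * c M) (k * d M)

scalar : ℤ → Mat2
scalar k = mat k (+ 0) (+ 0) k

tr : Mat2 → ℤ
tr M = a M + d M

mat-≡ : ∀ {a₁ b₁ c₁ d₁ a₂ b₂ c₂ d₂} →
        a₁ ≡ a₂ → b₁ ≡ b₂ → c₁ ≡ c₂ → d₁ ≡ d₂ → mat a₁ b₁ c₁ d₁ ≡ mat a₂ b₂ c₂ d₂
mat-≡ refl refl refl refl = refl

det-· : ∀ M N → det (M · N) ≡ det M * det N
det-· (mat x y z w) (mat x′ y′ z′ w′) = multiplicative x y z w x′ y′ z′ w′
  where
  multiplicative : ∀ x y z w x′ y′ z′ w′ →
    (x * x′ + y * z′) * (z * y′ + w * w′) - (x * y′ + y * w′) * (z * x′ + w * z′)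
      ≡ (x * w - y * z) * (x′ * w′ - y′ * z′)
  multiplicative = solve-∀

·-assoc : ∀ M N K → (M · N) · K ≡ M · (N · K)
·-assoc (mat x y z w) (mat x′ y′ z′ w′) (mat x″ y″ z″ w″) =
  mat-≡ (assoc x y x′ y′ z′ w′ x″ z″) (assoc x y x′ y′ z′ w′ y″ w″)
        (assoc z w x′ y′ z′ w′ x″ z″) (assoc z w x′ y′ z′ w′ y″ w″)
  where
  assoc : ∀ x y x′ y′ z′ w′ s t →
          (x * x′ + y * z′) * s + (x * y′ + y * w′) * t ≡ x * (x′ * s + y′ * t) + y * (z′ * s + w′ * t)
  assoc = solve-∀

·-identityˡ : ∀ M → I₂ · M ≡ M
·-identityˡ (mat x y z w) = mat-≡ (first x z) (first y w) (second x z) (second y w)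
  where
  first : ∀ s t → + 1 * s + + 0 * t ≡ s
  second : ∀ s t → + 0 * s + + 1 * t ≡ t
  first s t = trans (cong₂ _+_ (ℤ.*-identityˡ s) (ℤ.*-zeroˡ t)) (ℤ.+-identityʳ s)
  second s t = trans (cong₂ _+_ (ℤ.*-zeroˡ s) (ℤ.*-identityˡ t)) (ℤ.+-identityˡ t)

·-identityʳ : ∀ M → M · I₂ ≡ M
·-identityʳ (mat x y z w) = mat-≡ (first x y) (second x y) (first z w) (second z w)
  where
  first : ∀ s t → s * + 1 + t * + 0 ≡ s
  second : ∀ s t → s * + 0 + t * + 1 ≡ t
  first s t = trans (cong₂ _+_ (ℤ.*-identityʳ s) (ℤ.*-zeroʳ t)) (ℤ.+-identityʳ s)
  second s t = trans (cong₂ _+_ (ℤ.*-zeroʳ s) (ℤ.*-identityʳ t)) (ℤ.+-identityˡ t)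

⋆-identityˡ : ∀ M → + 1 ⋆ M ≡ M
⋆-identityˡ (mat x y z w) = mat-≡ (ℤ.*-identityˡ x) (ℤ.*-identityˡ y) (ℤ.*-identityˡ z) (ℤ.*-identityˡ w)

⋆inv-· : ∀ k M → (k ⋆ inv M) · M ≡ scalar (k * det M)
⋆inv-· k (mat x y z w) = mat-≡ (e₁ k x y z w) (e₂ k y w) (e₃ k x z) (e₄ k x y z w)
  where
  e₁ : ∀ k x y z w → k * w * x + k * - y * z ≡ k * (x * w - y * z)
  e₁ = solve-∀
  e₂ : ∀ k y w → k * w * y + k * - y * w ≡ + 0
  e₂ = solve-∀
  e₃ : ∀ k x z → k * - z * x + k * x * z ≡ + 0
  e₃ = solve-∀
  e₄ : ∀ k x y z w → k * - z * y + k * x * w ≡ k * (x * w - y * z)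
  e₄ = solve-∀

·-⋆inv : ∀ k M → M · (k ⋆ inv M) ≡ scalar (k * det M)
·-⋆inv k (mat x y z w) = mat-≡ (e₁ k x y z w) (e₂ k x y) (e₃ k z w) (e₄ k x y z w)
  where
  e₁ : ∀ k x y z w → x * (k * w) + y * (k * - z) ≡ k * (x * w - y * z)
  e₁ = solve-∀
  e₂ : ∀ k x y → x * (k * - y) + y * (k * x) ≡ + 0
  e₂ = solve-∀
  e₃ : ∀ k z w → z * (k * w) + w * (k * - z) ≡ + 0
  e₃ = solve-∀
  e₄ : ∀ k x y z w → z * (k * - y) + w * (k * x) ≡ k * (x * w - y * z)
  e₄ = solve-∀

-- Congruences modulo p

pos-Bézout : ∀ a b m n → 1 ℕ.+ a ℕ.* m ≡ b ℕ.* n → + 1 + + a * + m ≡ + b * + n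
pos-Bézout a b m n eq = begin
  + 1 + + a * + m    ≡⟨ cong (_+_ (+ 1)) (ℤ.pos-* a m) ⟨
  + (1 ℕ.+ a ℕ.* m)  ≡⟨ cong +_ eq ⟩
  + (b ℕ.* n)        ≡⟨ ℤ.pos-* b n ⟩
  + b * + n          ∎
  where open ≡-Reasoning

module Congruence (p : ℕ) where

  infix 4 _≈_ _≈?_

  -- A record rather than x ≡[ p ] y itself, so that x and y can be inferred from a proof.
  record _≈_ (x y : ℤ) : Set where
    constructor mk≈
    field un≈ : x ≡[ p ] y
  open _≈_ public

  ≈-intro : ∀ {x y} k → x ≡ y + k * + p → x ≈ y
  ≈-intro {x} {y} k x≡y+kp = mk≈ (ℤS.∣⇒∣ᵤ (ℤS.divides k (trans (cong (_- y) x≡y+kp) (cancel y (k * + p)))))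
    where
    cancel : ∀ y z → y + z - y ≡ z
    cancel = solve-∀

  ≈-elim : ∀ {x y} → x ≈ y → ∃ λ k → x ≡ y + k * + p
  ≈-elim {x} {y} (mk≈ p∣x-y) with ℤS.divides k x-y≡kp ← ℤS.∣ᵤ⇒∣ p∣x-y =
    k , trans (split x y) (cong (_+_ y) x-y≡kp)
    where
    split : ∀ x y → x ≡ y + (x - y)
    split = solve-∀

  ≡⇒≈ : ∀ {x y} → x ≡ y → x ≈ y
  ≡⇒≈ {x} refl = ≈-intro (+ 0) (sym (ℤ.+-identityʳ x))

  ≈-refl : ∀ {x} → x ≈ x
  ≈-refl = ≡⇒≈ refl

  ≈-sym : ∀ {x y} → x ≈ y → y ≈ x
  ≈-sym {y = y} x≈y with k , refl ← ≈-elim x≈y = ≈-intro (- k) (shift y k (+ p))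
    where
    shift : ∀ y k p → y ≡ y + k * p + - k * p
    shift = solve-∀

  ≈-trans : ∀ {x y z} → x ≈ y → y ≈ z → x ≈ z
  ≈-trans {z = z} x≈y y≈z with k , refl ← ≈-elim x≈y | l , refl ← ≈-elim y≈z = ≈-intro (l + k) (regroup z k l (+ p))
    where
    regroup : ∀ z k l p → z + l * p + k * p ≡ z + (l + k) * p
    regroup = solve-∀

  ≈-isEquivalence : IsEquivalence _≈_
  ≈-isEquivalence = record { refl = ≈-refl ; sym = ≈-sym ; trans = ≈-trans }

  ≈-setoid : Setoid 0ℓ 0ℓ
  ≈-setoid = record { isEquivalence = ≈-isEquivalence }

  module ≈-Reasoning = SetoidReasoning ≈-setoid

  +-cong : ∀ {x x′ y y′} → x ≈ x′ → y ≈ y′ → x + y ≈ x′ + y′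
  +-cong {x′ = x′} {y′ = y′} x≈x′ y≈y′ with k , refl ← ≈-elim x≈x′ | l , refl ← ≈-elim y≈y′ =
    ≈-intro (k + l) (regroup x′ y′ k l (+ p))
    where
    regroup : ∀ x y k l p → x + k * p + (y + l * p) ≡ x + y + (k + l) * p
    regroup = solve-∀

  *-cong : ∀ {x x′ y y′} → x ≈ x′ → y ≈ y′ → x * y ≈ x′ * y′
  *-cong {x′ = x′} {y′ = y′} x≈x′ y≈y′ with k , refl ← ≈-elim x≈x′ | l , refl ← ≈-elim y≈y′ =
    ≈-intro (k * y′ + x′ * l + k * l * + p) (expand x′ y′ k l (+ p))
    where
    expand : ∀ x y k l p → (x + k * p) * (y + l * p) ≡ x * y + (k * y + x * l + k * l * p) * p
    expand = solve-∀

  *-congˡ : ∀ x {y y′} → y ≈ y′ → x * y ≈ x * y′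
  *-congˡ x = *-cong (≈-refl {x})

  *-congʳ : ∀ y {x x′} → x ≈ x′ → x * y ≈ x′ * y
  *-congʳ y x≈x′ = *-cong x≈x′ (≈-refl {y})

  -‿cong : ∀ {x x′} → x ≈ x′ → - x ≈ - x′
  -‿cong {x′ = x′} x≈x′ with k , refl ← ≈-elim x≈x′ = ≈-intro (- k) (negate x′ k (+ p))
    where
    negate : ∀ x k p → - (x + k * p) ≡ - x + - k * p
    negate = solve-∀

  –-cong : ∀ {x x′ y y′} → x ≈ x′ → y ≈ y′ → x - y ≈ x′ - y′
  –-cong x≈x′ y≈y′ = +-cong x≈x′ (-‿cong y≈y′)

  _≈?_ : Decidable _≈_
  x ≈? y = map′ mk≈ un≈ (p ℕ.∣? ∣ x - y ∣)

  [_≈_] : ℤ → ℤ → ℤ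
  [ x ≈ y ] = 𝟙 (x ≈? y)

  [≈]-cong : ∀ {x x′ y y′} → x ≈ x′ → y ≈ y′ → [ x ≈ y ] ≡ [ x′ ≈ y′ ]
  [≈]-cong x≈x′ y≈y′ = 𝟙-cong (_ ≈? _) (_ ≈? _) (mk⇔
    (λ x≈y → ≈-trans (≈-sym x≈x′) (≈-trans x≈y y≈y′))
    (λ x′≈y′ → ≈-trans x≈x′ (≈-trans x′≈y′ (≈-sym y≈y′))))

  ≈-rearrange : ∀ {a b c d} → a ≈ b → a - b ≡ c - d → c ≈ d
  ≈-rearrange (mk≈ p∣a-b) a-b≡c-d = mk≈ (subst (λ t → p ℕ.∣ ∣ t ∣) a-b≡c-d p∣a-b)

  ≈-rearrange⇔ : ∀ {a b c d} → a - b ≡ c - d → a ≈ b ⇔ c ≈ d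
  ≈-rearrange⇔ a-b≡c-d = mk⇔ (λ a≈b → ≈-rearrange a≈b a-b≡c-d) (λ c≈d → ≈-rearrange c≈d (sym a-b≡c-d))

  [≈]-sym : ∀ x y → [ x ≈ y ] ≡ [ y ≈ x ]
  [≈]-sym x y = 𝟙-cong (x ≈? y) (y ≈? x) (mk⇔ ≈-sym ≈-sym)

  divides?-𝟙 : ∀ x y → (if divides? p (x - y) then + p else + 0) ≡ + p * [ x ≈ y ]
  divides?-𝟙 x y with p ℕ.∣? ∣ x - y ∣
  ... | yes _ = sym (ℤ.*-identityʳ (+ p))
  ... | no _  = sym (ℤ.*-zeroʳ (+ p))

  *-invert : ∀ {y y′ z t} → y * y′ ≈ + 1 → y * z ≈ t ⇔ z ≈ y′ * t
  *-invert {y} {y′} {z} {t} yy′≈1 = mk⇔ to from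
    where
    open ≈-Reasoning
    to : y * z ≈ t → z ≈ y′ * t
    to yz≈t = begin
      z             ≡⟨ solve (z ∷ []) ⟩
      + 1 * z       ≈⟨ *-congʳ z (≈-sym yy′≈1) ⟩
      y * y′ * z    ≡⟨ solve (y ∷ y′ ∷ z ∷ []) ⟩
      y′ * (y * z)  ≈⟨ *-congˡ y′ yz≈t ⟩
      y′ * t        ∎
    from : z ≈ y′ * t → y * z ≈ t
    from z≈y′t = begin
      y * z         ≈⟨ *-congˡ y z≈y′t ⟩
      y * (y′ * t)  ≡⟨ solve (y ∷ y′ ∷ t ∷ []) ⟩
      y * y′ * t    ≈⟨ *-congʳ t yy′≈1 ⟩
      + 1 * t       ≡⟨ solve (t ∷ []) ⟩
      t             ∎

  *-cancelˡ-≈ : ∀ {y y′ a b} → y * y′ ≈ + 1 → y * a ≈ y * b → a ≈ b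
  *-cancelˡ-≈ {y} {y′} {a} {b} yy′≈1 ya≈yb = begin
    a             ≈⟨ Equivalence.to (*-invert {y} {y′} {a} {y * b} yy′≈1) ya≈yb ⟩
    y′ * (y * b)  ≡⟨ solve (y ∷ y′ ∷ b ∷ []) ⟩
    y * y′ * b    ≈⟨ *-congʳ b yy′≈1 ⟩
    + 1 * b       ≡⟨ ℤ.*-identityˡ b ⟩
    b             ∎
    where open ≈-Reasoning

  ≈0⇒∣ : ∀ {x} → x ≈ + 0 → p ℕ.∣ ∣ x ∣
  ≈0⇒∣ {x} (mk≈ p∣x-0) = subst (λ z → p ℕ.∣ ∣ z ∣) (ℤ.+-identityʳ x) p∣x-0

  ∣⇒≈0 : ∀ {x} → p ℕ.∣ ∣ x ∣ → x ≈ + 0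
  ∣⇒≈0 {x} p∣x = mk≈ (subst (λ z → p ℕ.∣ ∣ z ∣) (sym (ℤ.+-identityʳ x)) p∣x)

  infix 4 _≈ₘ_ _≈ₘ?_

  _≈ₘ_ : Mat2 → Mat2 → Set
  M ≈ₘ N = a M ≈ a N × b M ≈ b N × c M ≈ c N × d M ≈ d N

  ≈ₘ-sym : ∀ {M N} → M ≈ₘ N → N ≈ₘ M
  ≈ₘ-sym (≈a , ≈b , ≈c , ≈d) = ≈-sym ≈a , ≈-sym ≈b , ≈-sym ≈c , ≈-sym ≈d

  ≈ₘ-trans : ∀ {M N K} → M ≈ₘ N → N ≈ₘ K → M ≈ₘ K
  ≈ₘ-trans (≈a , ≈b , ≈c , ≈d) (≈a′ , ≈b′ , ≈c′ , ≈d′) =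
    ≈-trans ≈a ≈a′ , ≈-trans ≈b ≈b′ , ≈-trans ≈c ≈c′ , ≈-trans ≈d ≈d′

  ≡⇒≈ₘ : ∀ {M N} → M ≡ N → M ≈ₘ N
  ≡⇒≈ₘ refl = ≈-refl , ≈-refl , ≈-refl , ≈-refl

  ≈ₘ-refl : ∀ {M} → M ≈ₘ M
  ≈ₘ-refl = ≡⇒≈ₘ refl

  ≈ₘ-isEquivalence : IsEquivalence _≈ₘ_
  ≈ₘ-isEquivalence = record { refl = ≈ₘ-refl ; sym = ≈ₘ-sym ; trans = ≈ₘ-trans }

  ≈ₘ-setoid : Setoid 0ℓ 0ℓ
  ≈ₘ-setoid = record { isEquivalence = ≈ₘ-isEquivalence }

  module ≈ₘ-Reasoning = SetoidReasoning ≈ₘ-setoid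

  ≡M⇒≈ₘ : ∀ {M N} → M ≡M[ p ] N → M ≈ₘ N
  ≡M⇒≈ₘ (≡a , ≡b , ≡c , ≡d) = mk≈ ≡a , mk≈ ≡b , mk≈ ≡c , mk≈ ≡d

  ≈ₘ⇒≡M : ∀ {M N} → M ≈ₘ N → M ≡M[ p ] N
  ≈ₘ⇒≡M (≈a , ≈b , ≈c , ≈d) = un≈ ≈a , un≈ ≈b , un≈ ≈c , un≈ ≈d

  _≈ₘ?_ : Decidable _≈ₘ_
  M ≈ₘ? N = a M ≈? a N ×-dec b M ≈? b N ×-dec c M ≈? c N ×-dec d M ≈? d N

  ·-cong : ∀ {M M′ N N′} → M ≈ₘ M′ → N ≈ₘ N′ → M · N ≈ₘ M′ · N′
  ·-cong (≈a , ≈b , ≈c , ≈d) (≈a′ , ≈b′ , ≈c′ , ≈d′) =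
    +-cong (*-cong ≈a ≈a′) (*-cong ≈b ≈c′) , +-cong (*-cong ≈a ≈b′) (*-cong ≈b ≈d′) ,
    +-cong (*-cong ≈c ≈a′) (*-cong ≈d ≈c′) , +-cong (*-cong ≈c ≈b′) (*-cong ≈d ≈d′)

  det-cong : ∀ {M N} → M ≈ₘ N → det M ≈ det N
  det-cong (≈a , ≈b , ≈c , ≈d) = –-cong (*-cong ≈a ≈d) (*-cong ≈b ≈c)

  tr-cong : ∀ {M N} → M ≈ₘ N → tr M ≈ tr N
  tr-cong (≈a , _ , _ , ≈d) = +-cong ≈a ≈d

  ⋆inv-inverse : ∀ {δ} N → δ * det N ≈ + 1 → (δ ⋆ inv N) · N ≈ₘ I₂ × N · (δ ⋆ inv N) ≈ₘ I₂
  ⋆inv-inverse {δ} N δΔ≈1 = ≈ₘ-trans (≡⇒≈ₘ (⋆inv-· δ N)) unit , ≈ₘ-trans (≡⇒≈ₘ (·-⋆inv δ N)) unit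
    where
    unit : scalar (δ * det N) ≈ₘ I₂
    unit = δΔ≈1 , ≈-refl , ≈-refl , δΔ≈1

  inv-inverse : ∀ M → det M ≡ + 1 → inv M · M ≈ₘ I₂ × M · inv M ≈ₘ I₂
  inv-inverse M det≡1 = subst (λ K → K · M ≈ₘ I₂ × M · K ≈ₘ I₂) (⋆-identityˡ (inv M))
                              (⋆inv-inverse {+ 1} M (≡⇒≈ (trans (ℤ.*-identityˡ (det M)) det≡1)))

  ·-cancelˡ : ∀ {K N} → K · N ≈ₘ I₂ → ∀ γ → K · (N · γ) ≈ₘ γ
  ·-cancelˡ {K} {N} KN≈I γ = begin
    K · (N · γ)  ≡⟨ ·-assoc K N γ ⟨
    (K · N) · γ  ≈⟨ ·-cong KN≈I (≡⇒≈ₘ {γ} refl) ⟩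
    I₂ · γ       ≡⟨ ·-identityˡ γ ⟩
    γ            ∎
    where open ≈ₘ-Reasoning

  ·-cancelʳ : ∀ {K N} → K · N ≈ₘ I₂ → ∀ γ → (γ · K) · N ≈ₘ γ
  ·-cancelʳ {K} {N} KN≈I γ = begin
    (γ · K) · N  ≡⟨ ·-assoc γ K N ⟩
    γ · (K · N)  ≈⟨ ·-cong (≡⇒≈ₘ {γ} refl) KN≈I ⟩
    γ · I₂       ≡⟨ ·-identityʳ γ ⟩
    γ            ∎
    where open ≈ₘ-Reasoning

  module _ .{{_ : ℕ.NonZero p}} where

    residues : List ℤ
    residues = map +_ (upTo p)

    length-residues : length residues ≡ p
    length-residues = trans (length-map +_ (upTo p)) (length-upTo p)

    ≈-residue : ∀ z → ∃ λ r → r ℕ.< p × + r ≈ z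
    ≈-residue z = z %ℕ p , n%ℕd<d z p , ≈-sym (≈-intro (z ℤ./ℕ p) (a≡a%ℕn+[a/ℕn]*n z p))

    <-≈-injective : ∀ {i j} → i ℕ.< p → j ℕ.< p → + i ≈ + j → i ≡ j
    <-≈-injective {i} {j} i<p j<p (mk≈ p∣i-j) = ℤ.+-injective (ℤ.i-j≡0⇒i≡j _ _ (ℤ.∣i∣≡0⇒i≡0 ∣i-j∣≡0))
      where
      ∣i-j∣<p : ∣ + i - + j ∣ ℕ.< p
      ∣i-j∣<p = ℕ.≤-<-trans (subst (ℕ._≤ i ℕ.⊔ j) (cong ∣_∣ (sym (ℤ.m-n≡m⊖n i j))) (ℤ.∣m⊝n∣≤m⊔n i j))
                            (ℕ.⊔-lub i<p j<p)
      ∣i-j∣≡0 : ∣ + i - + j ∣ ≡ 0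
      ∣i-j∣≡0 = trans (sym (ℕ.m<n⇒m%n≡m ∣i-j∣<p)) (ℕ.n∣m⇒m%n≡0 _ p p∣i-j)

    ∑residues-𝟙 : ∀ z → ∑ residues (λ x → [ x ≈ z ]) ≡ + 1
    ∑residues-𝟙 z = trans (∑-map +_ (upTo p) _) (∑-𝟙-unique (λ i → + i ≈? z) unique exists)
      where
      exists : Any (λ i → + i ≈ z) (upTo p)
      exists with r , r<p , r≈z ← ≈-residue z = lose (∈-upTo⁺ r<p) r≈z
      unique : AllPairs (λ i j → + i ≈ z → ¬ + j ≈ z) (upTo p)
      unique = applyUpTo⁺₁ id p (λ i<j j<p i≈z j≈z →
        ℕ.<⇒≢ i<j (<-≈-injective (ℕ.<-trans i<j j<p) j<p (≈-trans i≈z (≈-sym j≈z))))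

    ∑ₚ : (ℤ → ℤ) → ℤ
    ∑ₚ = ∑ residues

    pairs : List (ℤ × ℤ)
    pairs = concatMap (λ x → map (x ,_) residues) residues

    ∑-pairs : ∀ f → ∑ pairs f ≡ ∑ₚ λ x → ∑ₚ λ y → f (x , y)
    ∑-pairs f = trans (∑-concatMap _ residues f) (∑-cong residues λ x → ∑-map (x ,_) residues f)

    -- The diagonal (x, w) is enumerated outermost: once it is fixed, det ≈ Δ becomes y z ≈ x w − Δ.
    matrices : List Mat2
    matrices = concatMap (λ (x , w) → map (λ (y , z) → mat x y z w) pairs) pairs

    ∑-matrices : ∀ f → ∑ matrices f ≡ ∑ pairs λ (x , w) → ∑ pairs λ (y , z) → f (mat x y z w)
    ∑-matrices f = trans (∑-concatMap _ pairs f) (∑-cong pairs λ (x , w) → ∑-map _ pairs f)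

    ∑matrices-𝟙 : ∀ Z → ∑ matrices (λ γ → 𝟙 (γ ≈ₘ? Z)) ≡ + 1
    ∑matrices-𝟙 Z@(mat s t u v) = begin
      ∑ matrices (λ γ → 𝟙 (γ ≈ₘ? Z))
        ≡⟨ ∑-matrices _ ⟩
      (∑ pairs λ (x , w) → ∑ pairs λ (y , z) → 𝟙 (mat x y z w ≈ₘ? Z))
        ≡⟨ ∑-cong pairs (λ (x , w) → ∑-cong pairs λ (y , z) → split x y z w) ⟩
      (∑ pairs λ (x , w) → ∑ pairs λ (y , z) → ([ x ≈ s ] * [ w ≈ v ]) * ([ y ≈ t ] * [ z ≈ u ]))
        ≡⟨ ∑-product pairs pairs _ _ ⟩
      (∑ pairs λ (x , w) → [ x ≈ s ] * [ w ≈ v ]) * (∑ pairs λ (y , z) → [ y ≈ t ] * [ z ≈ u ])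
        ≡⟨ cong₂ _*_ (∑pairs-𝟙 s v) (∑pairs-𝟙 t u) ⟩
      + 1 ∎
      where
      open ≡-Reasoning
      regroup : ∀ α β γ δ → α * (β * (γ * δ)) ≡ (α * δ) * (β * γ)
      regroup = solve-∀
      split : ∀ x y z w → 𝟙 (mat x y z w ≈ₘ? Z) ≡ ([ x ≈ s ] * [ w ≈ v ]) * ([ y ≈ t ] * [ z ≈ u ])
      split x y z w = begin
        𝟙 (mat x y z w ≈ₘ? Z)
          ≡⟨ 𝟙-× (x ≈? s) _ ⟩
        [ x ≈ s ] * 𝟙 (y ≈? t ×-dec z ≈? u ×-dec w ≈? v)
          ≡⟨ cong ([ x ≈ s ] *_) (trans (𝟙-× (y ≈? t) _) (cong ([ y ≈ t ] *_) (𝟙-× (z ≈? u) (w ≈? v)))) ⟩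
        [ x ≈ s ] * ([ y ≈ t ] * ([ z ≈ u ] * [ w ≈ v ]))
          ≡⟨ regroup [ x ≈ s ] [ y ≈ t ] [ z ≈ u ] [ w ≈ v ] ⟩
        ([ x ≈ s ] * [ w ≈ v ]) * ([ y ≈ t ] * [ z ≈ u ]) ∎
      ∑pairs-𝟙 : ∀ s t → (∑ pairs λ (x , y) → [ x ≈ s ] * [ y ≈ t ]) ≡ + 1
      ∑pairs-𝟙 s t = trans (∑-pairs _)
        (trans (∑-product residues residues _ _) (cong₂ _*_ (∑residues-𝟙 s) (∑residues-𝟙 t)))

    module ℤₚ = ResidueSystem ≈-isEquivalence _≈?_ residues ∑residues-𝟙
    module Matₚ = ResidueSystem ≈ₘ-isEquivalence _≈ₘ?_ matrices ∑matrices-𝟙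

  module _ (p-prime : Prime p) where

    private instance
      p≢0 : ℕ.NonZero p
      p≢0 = prime⇒nonZero p-prime

    *≈0⇒≈0 : ∀ {x y} → x * y ≈ + 0 → x ≈ + 0 ⊎ y ≈ + 0
    *≈0⇒≈0 {x} {y} xy≈0 =
      Sum.map ∣⇒≈0 ∣⇒≈0 (euclidsLemma ∣ x ∣ ∣ y ∣ p-prime (subst (p ℕ.∣_) (ℤ.abs-* x y) (≈0⇒∣ xy≈0)))

    -- Opaque, so that the Bézout computation is never unfolded while comparing types.
    opaque
      ≉0⇒invertible : ∀ {x} → ¬ x ≈ + 0 → ∃ λ y → x * y ≈ + 1
      ≉0⇒invertible {x} x≉0 with r , r<p , r≈x ← ≈-residue x =
        map₂ (≈-trans (*-congʳ _ (≈-sym r≈x))) r-invertible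
        where
        instance
          r≢0 : ℕ.NonZero r
          r≢0 = ℕ.≢-nonZero λ { refl → x≉0 (≈-sym r≈x) }
        r-invertible : ∃ λ y → + r * y ≈ + 1
        r-invertible with coprime-Bézout (prime⇒coprime p-prime r<p)
        ... | Bézout.+- a b eq = - + b , ≈-intro (- + a) (negated (+ r) (+ a) (+ b) (+ p) (pos-Bézout b a r p eq))
          where
          negated : ∀ r a b p → + 1 + b * r ≡ a * p → r * - b ≡ + 1 + - a * p
          negated r a b p eq = trans (rearrange₁ r b) (trans (cong (_-_ (+ 1)) eq) (rearrange₂ a p))
            where
            rearrange₁ : ∀ r b → r * - b ≡ + 1 - (+ 1 + b * r)
            rearrange₁ = solve-∀
            rearrange₂ : ∀ a p → + 1 - a * p ≡ + 1 + - a * p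
            rearrange₂ = solve-∀
        ... | Bézout.-+ a b eq = + b , ≈-intro (+ a) (trans (ℤ.*-comm (+ r) (+ b)) (sym (pos-Bézout a b p r eq)))

    ±-roots : ∀ {u Y D} → Y * Y ≈ D → u * u ≈ D ⇔ (u ≈ Y ⊎ u ≈ - Y)
    ±-roots {u} {Y} {D} Y²≈D = mk⇔ to from
      where
      open ≈-Reasoning
      to : u * u ≈ D → u ≈ Y ⊎ u ≈ - Y
      to u²≈D with *≈0⇒≈0 {u - Y} {u + Y} (begin
        (u - Y) * (u + Y)  ≡⟨ solve (u ∷ Y ∷ []) ⟩
        u * u - Y * Y      ≈⟨ –-cong u²≈D Y²≈D ⟩
        D - D              ≡⟨ ℤ.+-inverseʳ D ⟩
        + 0                ∎)
      ... | inj₁ u-Y≈0 = inj₁ (≈-rearrange u-Y≈0 (solve (u ∷ Y ∷ [])))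
      ... | inj₂ u+Y≈0 = inj₂ (≈-rearrange u+Y≈0 (solve (u ∷ Y ∷ [])))
      from : u ≈ Y ⊎ u ≈ - Y → u * u ≈ D
      from (inj₁ u≈Y)  = ≈-trans (*-cong u≈Y u≈Y) Y²≈D
      from (inj₂ u≈-Y) = begin
        u * u      ≈⟨ *-cong u≈-Y u≈-Y ⟩
        - Y * - Y  ≡⟨ solve (Y ∷ []) ⟩
        Y * Y      ≈⟨ Y²≈D ⟩
        D          ∎

    module _ (p-odd : ¬ 2 ℕ.∣ p) where

      2≉0 : ¬ + 2 ≈ + 0
      2≉0 2≈0 with prime⇒irreducible prime[2] (≈0⇒∣ 2≈0)
      ... | inj₁ refl = ¬prime[1] p-prime
      ... | inj₂ refl = p-odd ℕ.∣-refl

      root≉-root : ∀ {Y D} → ¬ p ℕ.∣ ∣ D ∣ → Y * Y ≈ D → ¬ Y ≈ - Y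
      root≉-root {Y} {D} p∤D Y²≈D Y≈-Y with *≈0⇒≈0 {+ 2} {Y} (≈-rearrange Y≈-Y (solve (Y ∷ [])))
      ... | inj₁ 2≈0 = 2≉0 2≈0
      ... | inj₂ Y≈0 = p∤D (≈0⇒∣ (≈-trans (≈-sym Y²≈D) (*-cong Y≈0 Y≈0)))

-- Point counts over 𝔽ₚ

module Counting (p : ℕ) (p-prime : Prime p) where

  open Congruence p

  private instance
    p≢0 : ℕ.NonZero p
    p≢0 = prime⇒nonZero p-prime

  ∑ₚ-const : ∀ c → ∑ₚ (λ _ → c) ≡ + p * c
  ∑ₚ-const c = trans (∑-const residues c) (cong (λ n → + n * c) length-residues)

  ∑ₚ-affine : ∀ f s t → ∑ₚ (λ x → s * f x + t) ≡ s * ∑ₚ f + + p * t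
  ∑ₚ-affine f s t = trans (∑-affine residues f s t) (cong (λ n → s * ∑ₚ f + + n * t) length-residues)

  ∑ₚ-split-at-0 : ∀ {F : ℤ → ℤ} {s t} → (∀ {y} → y ≈ + 0 → F y ≡ s) → (∀ {y} → ¬ y ≈ + 0 → F y ≡ t) →
                  ∑ₚ F ≡ s + (+ p - + 1) * t
  ∑ₚ-split-at-0 {F} {s} {t} F0 F≉0 = begin
    ∑ₚ F                                     ≡⟨ ∑-cong residues (λ y → 𝟙-case (y ≈? + 0) F0 F≉0) ⟩
    ∑ₚ (λ y → (s - t) * [ y ≈ + 0 ] + t)       ≡⟨ ∑ₚ-affine (λ y → [ y ≈ + 0 ]) (s - t) t ⟩
    (s - t) * ∑ₚ (λ y → [ y ≈ + 0 ]) + + p * t ≡⟨ cong (λ n → (s - t) * n + + p * t) (∑residues-𝟙 (+ 0)) ⟩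
    (s - t) * + 1 + + p * t                    ≡⟨ regroup s t (+ p) ⟩
    s + (+ p - + 1) * t                      ∎
    where
    open ≡-Reasoning
    regroup : ∀ s t n → (s - t) * + 1 + n * t ≡ s + (n - + 1) * t
    regroup = solve-∀

  #k≈yz : ∀ k → (∑ₚ λ y → ∑ₚ λ z → [ k ≈ y * z ]) ≡ + p * [ k ≈ + 0 ] + (+ p - + 1)
  #k≈yz k = trans (∑ₚ-split-at-0 y≈0-case y≉0-case) (cong (_+_ (+ p * [ k ≈ + 0 ])) (ℤ.*-identityʳ (+ p - + 1)))
    where
    y≈0-case : ∀ {y} → y ≈ + 0 → (∑ₚ λ z → [ k ≈ y * z ]) ≡ + p * [ k ≈ + 0 ]
    y≈0-case {y} y≈0 = trans (∑-cong residues (λ z → [≈]-cong (≈-refl {k}) (yz≈0 z))) (∑ₚ-const [ k ≈ + 0 ])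
      where
      yz≈0 : ∀ z → y * z ≈ + 0
      yz≈0 z = ≈-trans (*-congʳ z y≈0) (≡⇒≈ (ℤ.*-zeroˡ z))
    y≉0-case : ∀ {y} → ¬ y ≈ + 0 → (∑ₚ λ z → [ k ≈ y * z ]) ≡ + 1
    y≉0-case {y} y≉0 with y′ , yy′≈1 ← ≉0⇒invertible p-prime y≉0 =
      trans (∑-cong residues (λ z → 𝟙-cong (k ≈? y * z) (z ≈? y′ * k) (unique-z z))) (∑residues-𝟙 (y′ * k))
      where
      unique-z : ∀ z → k ≈ y * z ⇔ z ≈ y′ * k
      unique-z z = *-invert {y} {y′} {z} {k} yy′≈1 ⇔-∘ mk⇔ ≈-sym ≈-sym

  #det≈Δ : ∀ Δ (G : ℤ → ℤ → ℤ) → ∑ matrices (λ g → [ det g ≈ Δ ] * G (a g) (d g))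
           ≡ ∑ₚ λ x → ∑ₚ λ w → G x w * (+ p * [ x * w ≈ Δ ] + (+ p - + 1))
  #det≈Δ Δ G = begin
    ∑ matrices (λ g → [ det g ≈ Δ ] * G (a g) (d g))
      ≡⟨ ∑-matrices _ ⟩
    (∑ pairs λ (x , w) → ∑ pairs λ (y , z) → [ x * w - y * z ≈ Δ ] * G x w)
      ≡⟨ ∑-cong pairs (λ (x , w) → fibre x w) ⟩
    (∑ pairs λ (x , w) → G x w * (+ p * [ x * w ≈ Δ ] + (+ p - + 1)))
      ≡⟨ ∑-pairs _ ⟩
    (∑ₚ λ x → ∑ₚ λ w → G x w * (+ p * [ x * w ≈ Δ ] + (+ p - + 1)))  ∎
    where
    open ≡-Reasoning
    swap : ∀ m n k → m - n - k ≡ m - k - n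
    swap = solve-∀
    #yz : ∀ x w → (∑ pairs λ (y , z) → [ x * w - y * z ≈ Δ ]) ≡ + p * [ x * w ≈ Δ ] + (+ p - + 1)
    #yz x w = begin
      (∑ pairs λ (y , z) → [ x * w - y * z ≈ Δ ])
        ≡⟨ ∑-pairs _ ⟩
      (∑ₚ λ y → ∑ₚ λ z → [ x * w - y * z ≈ Δ ])
        ≡⟨ ∑-cong residues (λ y → ∑-cong residues λ z →
             𝟙-cong (x * w - y * z ≈? Δ) (x * w - Δ ≈? y * z) (≈-rearrange⇔ (swap (x * w) (y * z) Δ))) ⟩
      (∑ₚ λ y → ∑ₚ λ z → [ x * w - Δ ≈ y * z ])
        ≡⟨ #k≈yz (x * w - Δ) ⟩
      + p * [ x * w - Δ ≈ + 0 ] + (+ p - + 1)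
        ≡⟨ cong (λ t → + p * t + (+ p - + 1))
             (𝟙-cong (x * w - Δ ≈? + 0) (x * w ≈? Δ) (≈-rearrange⇔ (ℤ.+-identityʳ (x * w - Δ)))) ⟩
      + p * [ x * w ≈ Δ ] + (+ p - + 1)  ∎
    fibre : ∀ x w → (∑ pairs λ (y , z) → [ x * w - y * z ≈ Δ ] * G x w)
                    ≡ G x w * (+ p * [ x * w ≈ Δ ] + (+ p - + 1))
    fibre x w = begin
      (∑ pairs λ (y , z) → [ x * w - y * z ≈ Δ ] * G x w)  ≡⟨ *-distribʳ-∑ (G x w) pairs _ ⟨
      (∑ pairs λ (y , z) → [ x * w - y * z ≈ Δ ]) * G x w  ≡⟨ cong (_* G x w) (#yz x w) ⟩
      (+ p * [ x * w ≈ Δ ] + (+ p - + 1)) * G x w    ≡⟨ ℤ.*-comm _ (G x w) ⟩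
      G x w * (+ p * [ x * w ≈ Δ ] + (+ p - + 1))    ∎

  |SL₂| : ∑ matrices (λ g → [ det g ≈ + 1 ]) ≡ + p * (+ p * + p - + 1)
  |SL₂| = begin
    ∑ matrices (λ g → [ det g ≈ + 1 ])
      ≡⟨ ∑-cong matrices (λ g → sym (ℤ.*-identityʳ [ det g ≈ + 1 ])) ⟩
    ∑ matrices (λ g → [ det g ≈ + 1 ] * + 1)
      ≡⟨ #det≈Δ (+ 1) (λ _ _ → + 1) ⟩
    (∑ₚ λ x → ∑ₚ λ w → + 1 * (+ p * [ x * w ≈ + 1 ] + (+ p - + 1)))
      ≡⟨ ∑-cong residues (λ x → trans (∑-cong residues λ w → trans (ℤ.*-identityˡ _)
           (cong (λ t → + p * t + (+ p - + 1)) ([≈]-sym (x * w) (+ 1)))) (∑ₚ-affine _ (+ p) _)) ⟩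
    (∑ₚ λ x → + p * (∑ₚ λ w → [ + 1 ≈ x * w ]) + + p * (+ p - + 1))
      ≡⟨ ∑ₚ-affine _ (+ p) _ ⟩
    + p * (∑ₚ λ x → ∑ₚ λ w → [ + 1 ≈ x * w ]) + + p * (+ p * (+ p - + 1))
      ≡⟨ cong (λ t → + p * t + + p * (+ p * (+ p - + 1))) (#k≈yz (+ 1)) ⟩
    + p * (+ p * [ + 1 ≈ + 0 ] + (+ p - + 1)) + + p * (+ p * (+ p - + 1))
      ≡⟨ cong (λ t → + p * (+ p * t + (+ p - + 1)) + + p * (+ p * (+ p - + 1))) (𝟙-no (+ 1 ≈? + 0) 1≉0) ⟩
    + p * (+ p * + 0 + (+ p - + 1)) + + p * (+ p * (+ p - + 1))
      ≡⟨ regroup (+ p) ⟩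
    + p * (+ p * + p - + 1)  ∎
    where
    open ≡-Reasoning
    regroup : ∀ n → n * (n * + 0 + (n - + 1)) + n * (n * (n - + 1)) ≡ n * (n * n - + 1)
    regroup = solve-∀
    1≉0 : ¬ + 1 ≈ + 0
    1≉0 1≈0 = ¬prime[1] (subst Prime (ℕ.∣1⇒≡1 (≈0⇒∣ 1≈0)) p-prime)

  module _ (p-odd : ¬ 2 ℕ.∣ p) where

    -- The case split follows the definition of legendre, which searches for a square root among 0, …, p − 1.
    #u²≈D : ∀ D → ∑ₚ (λ u → [ u * u ≈ D ]) ≡ + 1 + legendre D p
    #u²≈D D with p ℕ.∣? ∣ D ∣
    ... | yes p∣D = trans (∑-cong residues (λ u → 𝟙-cong (u * u ≈? D) (u ≈? + 0) (u²≈D⇔u≈0 u))) (∑residues-𝟙 (+ 0))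
      where
      D≈0 : D ≈ + 0
      D≈0 = ∣⇒≈0 p∣D
      u²≈D⇔u≈0 : ∀ u → u * u ≈ D ⇔ u ≈ + 0
      u²≈D⇔u≈0 u = mk⇔ (λ u²≈D → Sum.[ id , id ] (*≈0⇒≈0 p-prime {u} {u} (≈-trans u²≈D D≈0)))
                       (λ u≈0 → ≈-trans (*-cong u≈0 u≈0) (≈-sym D≈0))
    ... | no p∤D with filter (λ y → p ℕ.∣? ∣ + y * + y - D ∣) (upTo p) in roots
    ...   | [] = begin
      ∑ₚ (λ u → [ u * u ≈ D ])
        ≡⟨ ∑-map +_ (upTo p) _ ⟩
      ∑ (upTo p) (λ y → [ + y * + y ≈ D ])
        ≡⟨ ∑-cong (upTo p) (λ y → 𝟙-cong _ _ (mk⇔ un≈ mk≈)) ⟩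
      ∑ (upTo p) (λ y → 𝟙 (p ℕ.∣? ∣ + y * + y - D ∣))
        ≡⟨ ∑-𝟙-filter (λ y → p ℕ.∣? ∣ + y * + y - D ∣) (upTo p) ⟩
      + length (filter (λ y → p ℕ.∣? ∣ + y * + y - D ∣) (upTo p))
        ≡⟨ cong (+_ ∘ length) roots ⟩
      + 0  ∎
      where open ≡-Reasoning
    ...   | y ∷ _ = begin
      ∑ₚ (λ u → [ u * u ≈ D ])
        ≡⟨ ∑-cong residues two-roots ⟩
      ∑ₚ (λ u → [ u ≈ + y ] + [ u ≈ - + y ])
        ≡⟨ ∑-distrib-+ residues _ _ ⟩
      ∑ₚ (λ u → [ u ≈ + y ]) + ∑ₚ (λ u → [ u ≈ - + y ])
        ≡⟨ cong₂ _+_ (∑residues-𝟙 (+ y)) (∑residues-𝟙 (- + y)) ⟩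
      + 1 + + 1  ∎
      where
      open ≡-Reasoning
      y²≈D : + y * + y ≈ D
      y²≈D = mk≈ (proj₂ (∈-filter⁻ (λ y → p ℕ.∣? ∣ + y * + y - D ∣) {y} {upTo p}
                                    (subst (y ∈_) (sym roots) (here refl))))
      two-roots : ∀ u → [ u * u ≈ D ] ≡ [ u ≈ + y ] + [ u ≈ - + y ]
      two-roots u = 𝟙-⊎ (u * u ≈? D) (u ≈? + y) (u ≈? - + y) (±-roots p-prime y²≈D)
        (λ (u≈y , u≈-y) → root≉-root p-prime p-odd p∤D y²≈D (≈-trans (≈-sym u≈y) u≈-y))

    #x[n-x]≈c : ∀ n c → ∑ₚ (λ x → [ x * (n - x) ≈ c ]) ≡ ∑ₚ (λ u → [ u * u ≈ n * n - + 4 * c ])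
    #x[n-x]≈c n c with h , 2h≈1 ← ≉0⇒invertible p-prime (2≉0 p-prime p-odd) =
      trans (∑-cong residues λ x → 𝟙-cong (x * (n - x) ≈? c) (φ x * φ x ≈? disc) (completed x))
            (ℤₚ.∑-reindex φ ψ φ-cong ψ-cong φψ ψφ (λ u≈v → [≈]-cong (*-cong u≈v u≈v) (≈-refl {disc})))
      where
      open ≈-Reasoning
      disc : ℤ
      disc = n * n - + 4 * c
      φ ψ : ℤ → ℤ
      φ x = + 2 * x - n
      ψ u = h * (u + n)
      φ-cong : φ Preserves _≈_ ⟶ _≈_
      φ-cong x≈y = –-cong (*-congˡ (+ 2) x≈y) (≈-refl {n})
      ψ-cong : ψ Preserves _≈_ ⟶ _≈_
      ψ-cong u≈v = *-congˡ h (+-cong u≈v (≈-refl {n}))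
      φψ : ∀ u → φ (ψ u) ≈ u
      φψ u = begin
        + 2 * (h * (u + n)) - n  ≡⟨ solve (h ∷ u ∷ n ∷ []) ⟩
        + 2 * h * (u + n) - n    ≈⟨ –-cong (*-congʳ (u + n) 2h≈1) (≈-refl {n}) ⟩
        + 1 * (u + n) - n        ≡⟨ solve (u ∷ n ∷ []) ⟩
        u                        ∎
      ψφ : ∀ x → ψ (φ x) ≈ x
      ψφ x = begin
        h * (+ 2 * x - n + n)    ≡⟨ solve (h ∷ x ∷ n ∷ []) ⟩
        + 2 * h * x              ≈⟨ *-congʳ x 2h≈1 ⟩
        + 1 * x                  ≡⟨ ℤ.*-identityˡ x ⟩
        x                        ∎
      4h²≈1 : + 4 * (h * h) ≈ + 1
      4h²≈1 = begin
        + 4 * (h * h)        ≡⟨ solve (h ∷ []) ⟩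
        + 2 * h * (+ 2 * h)  ≈⟨ *-cong 2h≈1 2h≈1 ⟩
        + 1                  ∎
      completed : ∀ x → x * (n - x) ≈ c ⇔ φ x * φ x ≈ disc
      completed x = mk⇔ to from
        where
        to : x * (n - x) ≈ c → φ x * φ x ≈ disc
        to x[n-x]≈c = begin
          (+ 2 * x - n) * (+ 2 * x - n)  ≡⟨ solve (x ∷ n ∷ []) ⟩
          n * n - + 4 * (x * (n - x))    ≈⟨ –-cong (≈-refl {n * n}) (*-congˡ (+ 4) x[n-x]≈c) ⟩
          n * n - + 4 * c                ∎
        from : (+ 2 * x - n) * (+ 2 * x - n) ≈ n * n - + 4 * c → x * (n - x) ≈ c
        from φ²≈disc = *-cancelˡ-≈ {+ 4} {h * h} {x * (n - x)} {c} 4h²≈1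
                         (≈-rearrange (≈-sym φ²≈disc) (solve (x ∷ n ∷ c ∷ [])))

    #det≈Δ∧tr≈n : ∀ Δ n → ∑ matrices (λ g → [ det g ≈ Δ ] * [ tr g ≈ n ])
                 ≡ + p * + p + + p * legendre (n * n - + 4 * Δ) p
    #det≈Δ∧tr≈n Δ n = begin
      ∑ matrices (λ g → [ det g ≈ Δ ] * [ tr g ≈ n ])
        ≡⟨ #det≈Δ Δ (λ x w → [ x + w ≈ n ]) ⟩
      (∑ₚ λ x → ∑ₚ λ w → [ x + w ≈ n ] * H x w)
        ≡⟨ ∑-cong residues (λ x → trans (∑-cong residues λ w → cong (_* H x w) (w=n-x x w))
                                        (ℤₚ.∑-select (n - x) (H-cong x))) ⟩
      ∑ₚ (λ x → + p * [ x * (n - x) ≈ Δ ] + (+ p - + 1))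
        ≡⟨ ∑ₚ-affine _ (+ p) _ ⟩
      + p * ∑ₚ (λ x → [ x * (n - x) ≈ Δ ]) + + p * (+ p - + 1)
        ≡⟨ cong (λ t → + p * t + + p * (+ p - + 1)) (trans (#x[n-x]≈c n Δ) (#u²≈D (n * n - + 4 * Δ))) ⟩
      + p * (+ 1 + legendre (n * n - + 4 * Δ) p) + + p * (+ p - + 1)
        ≡⟨ regroup (+ p) (legendre (n * n - + 4 * Δ) p) ⟩
      + p * + p + + p * legendre (n * n - + 4 * Δ) p  ∎
      where
      open ≡-Reasoning
      H : ℤ → ℤ → ℤ
      H x w = + p * [ x * w ≈ Δ ] + (+ p - + 1)
      H-cong : ∀ x → H x Preserves _≈_ ⟶ _≡_
      H-cong x w≈w′ = cong (λ t → + p * t + (+ p - + 1)) ([≈]-cong (*-congˡ x w≈w′) (≈-refl {Δ}))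
      w=n-x : ∀ x w → [ x + w ≈ n ] ≡ [ w ≈ n - x ]
      w=n-x x w = 𝟙-cong (x + w ≈? n) (w ≈? n - x) (≈-rearrange⇔ (shift x w n))
        where
        shift : ∀ x w n → x + w - n ≡ w - (n - x)
        shift = solve-∀
      regroup : ∀ n χ → n * (+ 1 + χ) + n * (n - + 1) ≡ n * n + n * χ
      regroup = solve-∀

-- The singular series at a good prime

ramanujan′-at-1 : ∀ k x → ramanujan′ (suc k) 1 x ≡ + 1
ramanujan′-at-1 k x rewrite dec-true (1 ℕ.∣? ∣ x ∣) (ℕ.1∣ ∣ x ∣) = refl

ramanujanSum-prime : ∀ {p} → Prime p → ∀ x → ramanujanSum p x ≡ (if divides? p x then + p else + 0) - + 1
ramanujanSum-prime {p@(suc (suc k))} p-prime x = begin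
  ramanujanSum p x
    ≡⟨ cong (λ ds → p∣x - sumℤ (map (λ d → ramanujan′ (suc k) d x) ds)) divisors ⟩
  p∣x - (ramanujan′ (suc k) 1 x + + 0)
    ≡⟨ cong (λ r → p∣x - (r + + 0)) (ramanujan′-at-1 k x) ⟩
  p∣x - + 1  ∎
  where
  open ≡-Reasoning
  p∣x : ℤ
  p∣x = if divides? p x then + p else + 0
  beyond-1 : List ℕ
  beyond-1 = applyUpTo (suc ∘ suc) k
  positive : All (1 ℕ.≤_) beyond-1
  positive = All.tabulate λ d∈ → case ∈-applyUpTo⁻ (suc ∘ suc) d∈ of λ where
    (_ , _ , refl) → ℕ.s≤s ℕ.z≤n
  non-divisors : All (λ d → ¬ d ℕ.∣ p) beyond-1
  non-divisors = All.tabulate λ d∈ → case ∈-applyUpTo⁻ (suc ∘ suc) d∈ of λ where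
    (_ , i<k , refl) d∣p → Prime.notComposite p-prime (composite (ℕ.s≤s (ℕ.s≤s i<k)) d∣p)
  divisors : filter (ℕ._∣? p) (filter (1 ℕ.≤?_) (upTo p)) ≡ 1 ∷ []
  divisors = begin
    filter (ℕ._∣? p) (1 ∷ filter (1 ℕ.≤?_) beyond-1)
      ≡⟨ cong (filter (ℕ._∣? p) ∘ (1 ∷_)) (filter-all (1 ℕ.≤?_) positive) ⟩
    filter (ℕ._∣? p) (1 ∷ beyond-1)
      ≡⟨ filter-accept (ℕ._∣? p) (ℕ.1∣ p) ⟩
    1 ∷ filter (ℕ._∣? p) beyond-1
      ≡⟨ cong (1 ∷_) (filter-none (ℕ._∣? p) non-divisors) ⟩
    1 ∷ []  ∎

/ℕ-cong : ∀ {x y} m n .{{_ : ℕ.NonZero m}} .{{_ : ℕ.NonZero n}} → x * + n ≡ y * + m → x /ℕ m ≡ y /ℕ n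
/ℕ-cong {x} {y} (suc m) (suc n) eq = ℚ.fromℚᵘ-cong {ℚᵘ.mkℚᵘ x m} {ℚᵘ.mkℚᵘ y n} (ℚᵘ.*≡* eq)

module Cosets (Γ : Mat2 → Set) (Γ-subgroup : IsSubgroupSL2 Γ) (p : ℕ) .{{_ : ℕ.NonZero p}}
              (surjective : ReductionSurjective Γ p) {reps : List Mat2} (cosets : IsCosetReps Γ p reps) where

  open IsSubgroupSL2 Γ-subgroup
  open Congruence p
  open ≈ₘ-Reasoning

  reps⊆Γ : All Γ reps
  reps⊆Γ = proj₁ cosets

  ∑reps-𝟙 : ∀ γ → det γ ≈ + 1 → ∑ reps (λ r → 𝟙 (γ ≈ₘ? r)) ≡ + 1
  ∑reps-𝟙 γ detγ≈1 = ∑-𝟙-unique (γ ≈ₘ?_) (AllPairs-map-All distinct reps⊆Γ (proj₂ (proj₂ cosets))) exists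
    where
    exists : Any (γ ≈ₘ_) reps
    exists =
      let γ′ , γ′∈Γ , γ′≡γ = surjective γ (un≈ detγ≈1)
          r , r∈reps , (_ , γ′r⁻¹≡I) = proj₁ (proj₂ cosets) γ′ γ′∈Γ
      in lose r∈reps (begin
        γ                 ≈⟨ ≈ₘ-sym (≡M⇒≈ₘ γ′≡γ) ⟩
        γ′                ≈⟨ ·-cancelʳ (proj₁ (inv-inverse r (inSL2 (All.lookup reps⊆Γ r∈reps)))) γ′ ⟨
        (γ′ · inv r) · r  ≈⟨ ·-cong (≡M⇒≈ₘ {γ′ · inv r} {I₂} γ′r⁻¹≡I) (≈ₘ-refl {r}) ⟩
        I₂ · r            ≡⟨ ·-identityˡ r ⟩
        r                 ∎)
    distinct : ∀ {r s} → Γ r → Γ s → ¬ SameCoset Γ p r s → γ ≈ₘ r → ¬ γ ≈ₘ s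
    distinct {r} {s} r∈Γ s∈Γ r≁s γ≈r γ≈s = r≁s (mul∈ r∈Γ (inv∈ s∈Γ) , ≈ₘ⇒≡M (begin
      r · inv s  ≈⟨ ·-cong (≈ₘ-trans (≈ₘ-sym γ≈r) γ≈s) (≈ₘ-refl {inv s}) ⟩
      s · inv s  ≈⟨ proj₂ (inv-inverse s (inSL2 s∈Γ)) ⟩
      I₂         ∎))

  ∑-reps : ∀ {F : Mat2 → ℤ} → F Preserves _≈ₘ_ ⟶ _≡_ → ∑ reps F ≡ ∑ matrices (λ γ → [ det γ ≈ + 1 ] * F γ)
  ∑-reps = Matₚ.∑-transversal (λ γ → det γ ≈? + 1) (λ γ≈δ detγ≈1 → ≈-trans (≈-sym (det-cong γ≈δ)) detγ≈1)
                              (All.map (≡⇒≈ ∘ inSL2) reps⊆Γ) ∑reps-𝟙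

module LinearForm (p : ℕ) (p-prime : Prime p) (A B C D : ℤ) (p∤Δ : ¬ p ℕ.∣ ∣ Δ A B C D ∣) where

  open Congruence p

  private instance
    p≢0 : ℕ.NonZero p
    p≢0 = prime⇒nonZero p-prime

  N : Mat2
  N = mat A C B D

  L≡tr : ∀ γ → L A B C D γ ≡ tr (N · γ)
  L≡tr (mat x y z w) = regroup A B C D x y z w
    where
    regroup : ∀ A B C D x y z w → A * x + B * y + C * z + D * w ≡ (A * x + C * z) + (B * y + D * w)
    regroup = solve-∀

  det-N : det N ≡ Δ A B C D
  det-N = cong (λ t → A * D - t) (ℤ.*-comm C B)

  L-cong : L A B C D Preserves _≈ₘ_ ⟶ _≈_
  L-cong (≈a , ≈b , ≈c , ≈d) = +-cong (+-cong (+-cong (*-congˡ A ≈a) (*-congˡ B ≈b)) (*-congˡ C ≈c)) (*-congˡ D ≈d)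

  ∑det≈1∧L≈n : ∀ n → ∑ matrices (λ γ → [ det γ ≈ + 1 ] * [ L A B C D γ ≈ n ])
                    ≡ ∑ matrices (λ g → [ det g ≈ Δ A B C D ] * [ tr g ≈ n ])
  ∑det≈1∧L≈n n with δ , Δδ≈1 ← ≉0⇒invertible p-prime {Δ A B C D} (p∤Δ ∘ ≈0⇒∣) =
    trans (∑-cong matrices pointwise)
          (Matₚ.∑-reindex (N ·_) (K ·_) (·-cong (≈ₘ-refl {N})) (·-cong (≈ₘ-refl {K}))
                          (·-cancelˡ {N} {K} NK≈I) (·-cancelˡ {K} {N} KN≈I) F-cong)
    where
    Δ₀ : ℤ
    Δ₀ = Δ A B C D
    K : Mat2
    K = δ ⋆ inv N
    δ·detN≈1 : δ * det N ≈ + 1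
    δ·detN≈1 = ≈-trans (≡⇒≈ (trans (cong (δ *_) det-N) (ℤ.*-comm δ Δ₀))) Δδ≈1
    KN≈I : K · N ≈ₘ I₂
    KN≈I = proj₁ (⋆inv-inverse {δ} N δ·detN≈1)
    NK≈I : N · K ≈ₘ I₂
    NK≈I = proj₂ (⋆inv-inverse {δ} N δ·detN≈1)
    F : Mat2 → ℤ
    F g = [ det g ≈ Δ₀ ] * [ tr g ≈ n ]
    F-cong : F Preserves _≈ₘ_ ⟶ _≡_
    F-cong g≈h = cong₂ _*_ ([≈]-cong (det-cong g≈h) (≈-refl {Δ₀})) ([≈]-cong (tr-cong g≈h) (≈-refl {n}))
    det-Nγ : ∀ γ → det (N · γ) ≡ Δ₀ * det γ
    det-Nγ γ = trans (det-· N γ) (cong (_* det γ) det-N)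
    scaled : ∀ γ → det γ ≈ + 1 ⇔ det (N · γ) ≈ Δ₀
    scaled γ = mk⇔
      (λ detγ≈1 → ≈-trans (≡⇒≈ (det-Nγ γ)) (≈-trans (*-congˡ Δ₀ detγ≈1) (≡⇒≈ (ℤ.*-identityʳ Δ₀))))
      (λ detNγ≈Δ₀ → *-cancelˡ-≈ {Δ₀} {δ} {det γ} {+ 1} Δδ≈1
         (≈-trans (≡⇒≈ (sym (det-Nγ γ))) (≈-trans detNγ≈Δ₀ (≡⇒≈ (sym (ℤ.*-identityʳ Δ₀))))))
    pointwise : ∀ γ → [ det γ ≈ + 1 ] * [ L A B C D γ ≈ n ] ≡ F (N · γ)
    pointwise γ = cong₂ _*_ (𝟙-cong (det γ ≈? + 1) (det (N · γ) ≈? Δ₀) (scaled γ))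
                            ([≈]-cong (≡⇒≈ {L A B C D γ} (L≡tr γ)) (≈-refl {n}))

pos-p²-1 : ∀ p .{{_ : ℕ.NonZero p}} → + (p ℕ.* p ∸ 1) ≡ + p * + p - + 1
pos-p²-1 p@(suc _) = begin
  + (p ℕ.* p ∸ 1)  ≡⟨ ℤ.⊖-≥ (ℕ.s≤s ℕ.z≤n) ⟨
  p ℕ.* p ⊖ 1      ≡⟨ ℤ.m-n≡m⊖n (p ℕ.* p) 1 ⟨
  + (p ℕ.* p) - + 1 ≡⟨ cong (_- + 1) (ℤ.pos-* p p) ⟩
  + p * + p - + 1  ∎
  where open ≡-Reasoning

pos-|SL₂| : ∀ p .{{_ : ℕ.NonZero p}} → + (p ℕ.* (p ℕ.* p ∸ 1)) ≡ + p * (+ p * + p - + 1)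
pos-|SL₂| p = trans (ℤ.pos-* p (p ℕ.* p ∸ 1)) (cong (+ p *_) (pos-p²-1 p))

singularSeries-ratio : ∀ {p} → Prime p → ∀ χ →
  (+ p * (+ p * + p + + p * χ) + + (p ℕ.* (p ℕ.* p ∸ 1)) * - + 1) /ℕ (p ℕ.* (p ℕ.* p ∸ 1))
    ≡ (+ 1 + + p * χ) /ℕ (p ℕ.* p ∸ 1)
singularSeries-ratio {p@(suc (suc _))} _ χ =
  /ℕ-cong {+ p * (+ p * + p + + p * χ) + + (p ℕ.* (p ℕ.* p ∸ 1)) * - + 1} {+ 1 + + p * χ}
          (p ℕ.* (p ℕ.* p ∸ 1)) (p ℕ.* p ∸ 1) (begin
  (+ p * (+ p * + p + + p * χ) + + (p ℕ.* (p ℕ.* p ∸ 1)) * - + 1) * + (p ℕ.* p ∸ 1)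
    ≡⟨ cong₂ (λ s t → (+ p * (+ p * + p + + p * χ) + s * - + 1) * t) (pos-|SL₂| p) (pos-p²-1 p) ⟩
  (+ p * (+ p * + p + + p * χ) + + p * (+ p * + p - + 1) * - + 1) * (+ p * + p - + 1)
    ≡⟨ cancel-p (+ p) χ ⟩
  (+ 1 + + p * χ) * (+ p * (+ p * + p - + 1))
    ≡⟨ cong ((+ 1 + + p * χ) *_) (pos-|SL₂| p) ⟨
  (+ 1 + + p * χ) * + (p ℕ.* (p ℕ.* p ∸ 1))  ∎)
  where
  open ≡-Reasoning
  cancel-p : ∀ P χ → (P * (P * P + P * χ) + P * (P * P - + 1) * - + 1) * (P * P - + 1) ≡ (+ 1 + P * χ) * (P * (P * P - + 1))
  cancel-p = solve-∀

module GoodPrime (Γ : Mat2 → Set) (Γ-subgroup : IsSubgroupSL2 Γ) (p : ℕ) (p-prime : Prime p) (p-odd : ¬ 2 ℕ.∣ p)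
                 (surjective : ReductionSurjective Γ p) (A B C D : ℤ) (p∤Δ : ¬ p ℕ.∣ ∣ Δ A B C D ∣)
                 {reps : List Mat2} (cosets : IsCosetReps Γ p reps) where

  private instance
    p≢0 : ℕ.NonZero p
    p≢0 = prime⇒nonZero p-prime

  open Congruence p
  open Counting p p-prime
  open LinearForm p p-prime A B C D p∤Δ
  open Cosets Γ Γ-subgroup p surjective cosets

  length-reps : length reps ≡ p ℕ.* (p ℕ.* p ∸ 1)
  length-reps = ℤ.+-injective (begin
    + length reps                               ≡⟨ trans (∑-const reps (+ 1)) (ℤ.*-identityʳ _) ⟨
    ∑ reps (λ _ → + 1)                          ≡⟨ ∑-reps (λ _ → refl) ⟩
    ∑ matrices (λ γ → [ det γ ≈ + 1 ] * + 1)    ≡⟨ ∑-cong matrices (λ γ → ℤ.*-identityʳ [ det γ ≈ + 1 ]) ⟩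
    ∑ matrices (λ γ → [ det γ ≈ + 1 ])          ≡⟨ |SL₂| ⟩
    + p * (+ p * + p - + 1)                     ≡⟨ pos-|SL₂| p ⟨
    + (p ℕ.* (p ℕ.* p ∸ 1))                     ∎)
    where open ≡-Reasoning

  ∑-ramanujan : ∀ n → ∑ reps (λ γ → ramanujanSum p (L A B C D γ - n))
                      ≡ + p * (+ p * + p + + p * legendre (n * n - + 4 * Δ A B C D) p) + + (p ℕ.* (p ℕ.* p ∸ 1)) * - + 1
  ∑-ramanujan n = begin
    ∑ reps (λ γ → ramanujanSum p (L A B C D γ - n))
      ≡⟨ ∑-cong reps (λ γ → trans (ramanujanSum-prime p-prime _) (cong (_- + 1) (divides?-𝟙 (L A B C D γ) n))) ⟩
    ∑ reps (λ γ → + p * [ L A B C D γ ≈ n ] - + 1)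
      ≡⟨ ∑-affine reps _ (+ p) (- + 1) ⟩
    + p * ∑ reps (λ γ → [ L A B C D γ ≈ n ]) + + length reps * - + 1
      ≡⟨ cong₂ (λ t ℓ → + p * t + + ℓ * - + 1) #L≈n length-reps ⟩
    + p * (+ p * + p + + p * legendre (n * n - + 4 * Δ A B C D) p) + + (p ℕ.* (p ℕ.* p ∸ 1)) * - + 1  ∎
    where
    open ≡-Reasoning
    #L≈n : ∑ reps (λ γ → [ L A B C D γ ≈ n ]) ≡ + p * + p + + p * legendre (n * n - + 4 * Δ A B C D) p
    #L≈n = trans (∑-reps (λ γ≈δ → [≈]-cong (L-cong γ≈δ) (≈-refl {n})))
                 (trans (∑det≈1∧L≈n n) (#det≈Δ∧tr≈n p-odd (Δ A B C D) n))

lemma3p9 : (Γ : Mat2 → Set) → IsSubgroupSL2 Γ → ZariskiDenseSL2 Γ →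
           (A B C D : ℤ) → gcd (gcd (gcd A B) C) D ≡ + 1 →
           (p : ℕ) → Good Γ p → ¬ ((+ p) ∣ Δ A B C D) →
           (reps : List Mat2) → IsCosetReps Γ p reps →
           (n : ℤ) →
           singularSeries A B C D p n reps
             ≡ ((+ 1 Data.Integer.+ (+ p) Data.Integer.* legendre (n Data.Integer.* n - (+ 4) Data.Integer.* Δ A B C D) p) /ℕ (p ℕ.* p ∸ 1))
lemma3p9 Γ Γ-subgroup _ A B C D _ p (p-prime , p-odd , surjective) p∤Δ reps cosets n = begin
  singularSeries A B C D p n reps
    ≡⟨ cong₂ _/ℕ_ (∑-ramanujan n) length-reps ⟩
  (+ p * (+ p * + p + + p * χ) + + (p ℕ.* (p ℕ.* p ∸ 1)) * - + 1) /ℕ (p ℕ.* (p ℕ.* p ∸ 1))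
    ≡⟨ singularSeries-ratio p-prime χ ⟩
  (+ 1 + + p * χ) /ℕ (p ℕ.* p ∸ 1)  ∎
  where
  open ≡-Reasoning
  χ : ℤ
  χ = legendre (n * n - + 4 * Δ A B C D) p
  surjective-mod-p : ReductionSurjective Γ p
  surjective-mod-p = subst (ReductionSurjective Γ) (ℕ.*-identityʳ p) (surjective 1 (ℕ.s≤s ℕ.z≤n))
  open GoodPrime Γ Γ-subgroup p p-prime p-odd surjective-mod-p A B C D p∤Δ cosets
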